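{- Let $f,g,u,z$ be distinct alternatives and let $\mathcal D\subseteq\mathcal L(\{f,g,u,z\})$ be a peak-pit Condorcet domain with $R=fguz\in\mathcal D$ and $T=zugf\in\mathcal D$ such that $N_p(\mathcal D_{\{g,u,z\}})=\{uN_{\{g,u,z\}}1\}$. Let $\mathcal G=(G_1,\dots,G_k)$ be a geodesic on $\mathcal L(\{f,g,u\})$ connecting $R_{\{f,g,u\}}$ and $T_{\{f,g,u\}}$ such that $\mathcal D_{\{f,g,u\}}\cup\{G_1,\dots,G_k\}$ is a peak-pit Condorcet domain and $(g,u)$ is the first switching pair in $S(\mathcal G)$. Then $N_p(\mathcal D_{\{f,u,z\}})=\{uN_{\{f,u,z\}}1\}$.
   Context: Linear orders are written as words from top to bottom; $\mathcal D_B$ is the set of restrictions of orders of $\mathcal D$ to $B$. For distinct $p,q,r$, $x\in\{p,q,r\}$, $k\in\{1,2,3\}$, a domain satisfies the never-condition $xN_{\{p,q,r\}}k$ if none of its orders restricted to $\{p,q,r\}$ has $x$ in position $k$; those with $k=1$ (never-top) or $k=3$ (never-bottom) are peak-pit conditions, and $N_p(\cdot)$ is the set of peak-pit conditions satisfied. A peak-pit Condorcet domain is a domain whose restriction to every triple of distinct alternatives satisfies at least one peak-pit condition. Two orders are alike if they differ by swapping two adjacent alternatives $x,y$ (switching pair $(x,y)$); a geodesic is a path of alike orders of minimum length between its endpoints, and $S(\mathcal G)$ is its sequence of switching pairs. -}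

module Defs where

open import Data.Nat using (ℕ; zero; suc; _≤_)
open import Data.List using (List; []; _∷_; _++_; filter; length; head; last)
open import Data.List.Membership.Propositional using (_∈_)
open import Data.List.Membership.DecPropositional using () renaming (_∈?_ to ∈?-with)
open import Data.List.Relation.Unary.All using (All)
open import Data.List.Relation.Unary.Linked using (Linked)
open import Data.List.Relation.Binary.Permutation.Propositional using (_↭_)
open import Data.Maybe using (Maybe; just)
open import Data.Product using (Σ; ∃; ∃-syntax; _×_)
open import Data.Sum using (_⊎_)
open import Relation.Binary.Definitions using (DecidableEquality)
open import Relation.Binary.PropositionalEquality using (_≡_; _≢_)
open import Relation.Nullary using (¬_)
open import Function.Bundles using (_⇔_)

-- A linear order is a word (List A), read from top to bottom.
-- A domain is a predicate on words.
Domain : Set → Set₁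
Domain A = List A → Set

module _ {A : Set} where

  IsLinOrder : List A → List A → Set
  IsLinOrder X P = P ↭ X

  restrict : DecidableEquality A → List A → List A → List A
  restrict dec B P = filter (λ a → ∈?-with dec a B) P

  Restr : DecidableEquality A → Domain A → List A → Domain A
  Restr dec D B Q = ∃[ P ] (D P × restrict dec B P ≡ Q)

  -- At w k x : x is in position k (1-based, from the top) of w
  data At : List A → ℕ → A → Set where
    here  : ∀ {x w} → At (x ∷ w) 1 x
    there : ∀ {x y w k} → At w k x → At (y ∷ w) (suc k) x

  Never : DecidableEquality A → Domain A → A → A → A → A → ℕ → Set
  Never dec E p q r x k =
    ∀ P → E P → ¬ At (restrict dec (p ∷ q ∷ r ∷ []) P) k x

  PeakPitCD : DecidableEquality A → List A → Domain A → Set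
  PeakPitCD dec X E =
    ∀ p q r → p ∈ X → q ∈ X → r ∈ X → p ≢ q → q ≢ r → p ≢ r →
    ∃[ x ] ∃[ k ] (x ∈ p ∷ q ∷ r ∷ [] × (k ≡ 1 ⊎ k ≡ 3) × Never dec E p q r x k)

  -- N_p(E) on triple {p,q,r} equals { x0 N_{p,q,r} 1 }
  NpIsNeverTop : DecidableEquality A → Domain A → A → A → A → A → Set
  NpIsNeverTop dec E p q r x0 =
    ∀ x k → x ∈ p ∷ q ∷ r ∷ [] → (k ≡ 1 ⊎ k ≡ 3) →
    (Never dec E p q r x k ⇔ (x ≡ x0 × k ≡ 1))

  Switch : A → A → List A → List A → Set
  Switch x y w w' = ∃[ pre ] ∃[ suf ]
    (w ≡ pre ++ x ∷ y ∷ suf × w' ≡ pre ++ y ∷ x ∷ suf)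

  Alike : List A → List A → Set
  Alike w w' = ∃[ x ] ∃[ y ] Switch x y w w'

  PathOn : List A → List A → List A → List (List A) → Set
  PathOn X a b hs = All (IsLinOrder X) hs × Linked Alike hs
                    × head hs ≡ just a × last hs ≡ just b

  Geodesic : List A → List A → List A → List (List A) → Set
  Geodesic X a b gs = PathOn X a b gs ×
    (∀ hs → PathOn X a b hs → length gs ≤ length hs)

  FirstSwitch : A → A → List (List A) → Set
  FirstSwitch x y gs = ∃[ G₁ ] ∃[ G₂ ] ∃[ rest ]
    (gs ≡ G₁ ∷ G₂ ∷ rest × Switch x y G₁ G₂)

{-# OPTIONS --safe #-}
-- The geodesic starts with f g u, f u g (its first switch is (g,u)) and ends with u g f.
-- These three orders violate every peak-pit condition on {f,g,u} except g N 1, so in D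
-- the alternative g is never above both f and u.
-- If u were above f and z in some order of D, then, as u is never top on {g,u,z}, g is
-- above u and hence above f as well; so u N 1 holds on {f,u,z}. If u N 3 held on {f,u,z},
-- an order of D with u below g and z (which exists since u N 3 fails on {g,u,z}) would
-- have f below u, so again g would be above f and u. R and T refute the other four conditions.
-- Restrictions are evaluated by pulling the orders back along the injection F, G, U, Z ↦ f, g, u, z
-- of a concrete four-letter alphabet, on which they compute.
module Submission where

open import Defs
open import Data.List using (List; []; _∷_; map; head; last)
open import Data.List.Membership.Propositional using (_∈_)
open import Data.List.Membership.Propositional.Properties using (∈-map⁺; ∈-map⁻)
open import Data.List.Membership.DecPropositional using () renaming (_∈?_ to ∈?-with)
open import Data.List.Properties using (filter-accept; filter-reject; filter-idem; ∷-injectiveˡ; ∷-injectiveʳ)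
open import Data.List.Relation.Binary.Permutation.Propositional using (_↭_; ↭-sym)
open import Data.List.Relation.Binary.Permutation.Propositional.Properties
  using (↭-length; ∈-resp-↭; ↭-map-inv)
open import Data.List.Relation.Unary.All as All using (All)
open import Data.List.Relation.Unary.Any using (here; there)
open import Data.Maybe using (just)
open import Data.Nat as ℕ using (ℕ; suc)
open import Data.Product using (_,_; proj₁; proj₂)
open import Data.Sum as Sum using (_⊎_; inj₁; inj₂; [_,_]′)
open import Data.Empty using (⊥-elim)
open import Function using (_∘_)
open import Function.Bundles using (mk⇔; Equivalence)
open import Function.Definitions using (Injective)
open import Relation.Nullary using (¬_; Dec; yes; no; contradiction)
open import Relation.Nullary.Decidable using (map′; from-yes; _×-dec_; _⊎-dec_; _→-dec_)
open import Relation.Binary.Definitions using (DecidableEquality)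
open import Relation.Binary.PropositionalEquality using (_≡_; _≢_; refl; sym; cong; subst)
open Relation.Binary.PropositionalEquality.≡-Reasoning

module _ {A : Set} where

  At? : DecidableEquality A → ∀ w k x → Dec (At w k x)
  At? dec []      k             x = no λ ()
  At? dec (y ∷ w) 0             x = no λ ()
  At? dec (y ∷ w) 1             x = map′ (λ { refl → here }) (λ { here → refl }) (dec y x)
  At? dec (y ∷ w) (suc (suc k)) x = map′ there (λ { (there p) → p }) (At? dec w (suc k) x)

  At-map⁺ : ∀ {B : Set} (e : B → A) {w k x} → At w k x → At (map e w) k (e x)
  At-map⁺ e here      = here
  At-map⁺ e (there p) = there (At-map⁺ e p)

  At-map⁻ : ∀ {B : Set} {e : B → A} → Injective _≡_ _≡_ e →
            ∀ {w k x} → At (map e w) k (e x) → At w k x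
  At-map⁻ {e = e} e-inj = go refl
    where
    go : ∀ {w k a x} → a ≡ e x → At (map e w) k a → At w k x
    go {_ ∷ _} a≡ex here with refl ← e-inj a≡ex = here
    go {_ ∷ _} a≡ex (there p) = there (go a≡ex p)

  head-∈ : ∀ {xs : List A} {x} → head xs ≡ just x → x ∈ xs
  head-∈ {_ ∷ _} refl = here refl

  last-∈ : ∀ {xs : List A} {x} → last xs ≡ just x → x ∈ xs
  last-∈ {_ ∷ []}    refl = here refl
  last-∈ {_ ∷ _ ∷ _} eq   = there (last-∈ eq)

module _ {A : Set} (dec : DecidableEquality A) where

  restrict-idem : ∀ B P → restrict dec B (restrict dec B P) ≡ restrict dec B P
  restrict-idem B = filter-idem (λ a → ∈?-with dec a B)

  module _ {D : Domain A} {p q r x : A} {k : ℕ} where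

    Never-Restr⁺ : (∀ Q → D Q → ¬ At (restrict dec (p ∷ q ∷ r ∷ []) Q) k x) →
                   Never dec (Restr dec D (p ∷ q ∷ r ∷ [])) p q r x k
    Never-Restr⁺ never _ (Q , DQ , refl) =
      never Q DQ ∘ subst (λ v → At v k x) (restrict-idem _ Q)

    Never-Restr⁻ : Never dec (Restr dec D (p ∷ q ∷ r ∷ [])) p q r x k →
                   ∀ Q → D Q → ¬ At (restrict dec (p ∷ q ∷ r ∷ []) Q) k x
    Never-Restr⁻ never Q DQ =
      never _ (Q , DQ , refl) ∘ subst (λ v → At v k x) (sym (restrict-idem _ Q))

module _ {A B : Set} (decA : DecidableEquality A) (decB : DecidableEquality B)
         {e : B → A} (e-inj : Injective _≡_ _≡_ e) where

  ∈-map-injective : ∀ {x S} → e x ∈ map e S → x ∈ S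
  ∈-map-injective ex∈ with y , y∈S , ex≡ey ← ∈-map⁻ e ex∈ = subst (_∈ _) (sym (e-inj ex≡ey)) y∈S

  restrict-map : ∀ S w → restrict decA (map e S) (map e w) ≡ map e (restrict decB S w)
  restrict-map S []      = refl
  restrict-map S (x ∷ w) = by-membership (∈?-with decB x S)
    where
    by-membership : Dec (x ∈ S) → restrict decA (map e S) (map e (x ∷ w)) ≡ map e (restrict decB S (x ∷ w))
    by-membership (yes x∈S) = begin
      restrict decA (map e S) (e x ∷ map e w) ≡⟨ filter-accept (λ a → ∈?-with decA a (map e S)) (∈-map⁺ e x∈S) ⟩
      e x ∷ restrict decA (map e S) (map e w) ≡⟨ cong (e x ∷_) (restrict-map S w) ⟩
      map e (x ∷ restrict decB S w)           ≡⟨ cong (map e) (filter-accept (λ a → ∈?-with decB a S) x∈S) ⟨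
      map e (restrict decB S (x ∷ w))         ∎
    by-membership (no x∉S) = begin
      restrict decA (map e S) (e x ∷ map e w) ≡⟨ filter-reject (λ a → ∈?-with decA a (map e S)) (x∉S ∘ ∈-map-injective) ⟩
      restrict decA (map e S) (map e w)       ≡⟨ restrict-map S w ⟩
      map e (restrict decB S w)               ≡⟨ cong (map e) (filter-reject (λ a → ∈?-with decB a S) x∉S) ⟨
      map e (restrict decB S (x ∷ w))         ∎

  At-restrict-map⁺ : ∀ S w {k x} → At (restrict decB S w) k x → At (restrict decA (map e S) (map e w)) k (e x)
  At-restrict-map⁺ S w at = subst (λ v → At v _ _) (sym (restrict-map S w)) (At-map⁺ e at)

  At-restrict-map⁻ : ∀ S w {k x} → At (restrict decA (map e S) (map e w)) k (e x) → At (restrict decB S w) k x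
  At-restrict-map⁻ S w at = At-map⁻ e-inj (subst (λ v → At v _ _) (restrict-map S w) at)

pattern third = there (there here)

data Alt : Set where
  F G U Z : Alt

index : Alt → ℕ
index F = 0
index G = 1
index U = 2
index Z = 3

index-injective : Injective _≡_ _≡_ index
index-injective {F} {F} refl = refl
index-injective {G} {G} refl = refl
index-injective {U} {U} refl = refl
index-injective {Z} {Z} refl = refl

_≟_ : DecidableEquality Alt
a ≟ b = map′ index-injective (cong index) (index a ℕ.≟ index b)

all-Alt? : {P : Alt → Set} → (∀ a → Dec (P a)) → Dec (∀ a → P a)
all-Alt? P? = map′ (λ (pF , pG , pU , pZ) → λ { F → pF ; G → pG ; U → pU ; Z → pZ })
                   (λ ∀P → ∀P F , ∀P G , ∀P U , ∀P Z)
                   (P? F ×-dec P? G ×-dec P? U ×-dec P? Z)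

infixl 5 _↾_
_↾_ : List Alt → List Alt → List Alt
w ↾ S = restrict _≟_ S w

FGUZ ZUGF FGU FUG UGF GUZ FUZ : List Alt
FGUZ = F ∷ G ∷ U ∷ Z ∷ []
ZUGF = Z ∷ U ∷ G ∷ F ∷ []
FGU  = F ∷ G ∷ U ∷ []
FUG  = F ∷ U ∷ G ∷ []
UGF  = U ∷ G ∷ F ∷ []
GUZ  = G ∷ U ∷ Z ∷ []
FUZ  = F ∷ U ∷ Z ∷ []

u-top-fuz⇒u-top-guz⊎g-top-fgu : ∀ w → At (w ↾ FUZ) 1 U → At (w ↾ GUZ) 1 U ⊎ At (w ↾ FGU) 1 G
u-top-fuz⇒u-top-guz⊎g-top-fgu (U ∷ _) _  = inj₁ here
u-top-fuz⇒u-top-guz⊎g-top-fgu (G ∷ _) _  = inj₂ here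
u-top-fuz⇒u-top-guz⊎g-top-fgu (F ∷ _) (there ())
u-top-fuz⇒u-top-guz⊎g-top-fgu (Z ∷ _) (there ())

u-bottom-guz⇒u-bottom-fuz⊎g-top-fgu : ∀ w → FGUZ ↭ w → At (w ↾ GUZ) 3 U → At (w ↾ FUZ) 3 U ⊎ At (w ↾ FGU) 1 G
u-bottom-guz⇒u-bottom-fuz⊎g-top-fgu (a ∷ b ∷ c ∷ d ∷ []) π = on-words a b c d (All.tabulate (∈-resp-↭ π))
  where
  Claim : List Alt → Set
  Claim w = All (_∈ w) FGUZ → At (w ↾ GUZ) 3 U → At (w ↾ FUZ) 3 U ⊎ At (w ↾ FGU) 1 G

  claim? : ∀ w → Dec (Claim w)
  claim? w = All.all? (λ x → ∈?-with _≟_ x w) FGUZ →-dec At? _≟_ (w ↾ GUZ) 3 U →-dec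
             (At? _≟_ (w ↾ FUZ) 3 U ⊎-dec At? _≟_ (w ↾ FGU) 1 G)

  -- If g and z are above u, then either f is above u as well, so u is last among f, u, z,
  -- or f is below u, so g is above both u and f.
  on-words : ∀ a b c d → Claim (a ∷ b ∷ c ∷ d ∷ [])
  on-words = from-yes (all-Alt? λ a → all-Alt? λ b → all-Alt? λ c → all-Alt? λ d → claim? (a ∷ b ∷ c ∷ d ∷ []))
u-bottom-guz⇒u-bottom-fuz⊎g-top-fgu []                    π = contradiction (↭-length π) λ ()
u-bottom-guz⇒u-bottom-fuz⊎g-top-fgu (_ ∷ [])              π = contradiction (↭-length π) λ ()
u-bottom-guz⇒u-bottom-fuz⊎g-top-fgu (_ ∷ _ ∷ [])          π = contradiction (↭-length π) λ ()
u-bottom-guz⇒u-bottom-fuz⊎g-top-fgu (_ ∷ _ ∷ _ ∷ [])      π = contradiction (↭-length π) λ ()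
u-bottom-guz⇒u-bottom-fuz⊎g-top-fgu (_ ∷ _ ∷ _ ∷ _ ∷ _ ∷ _) π = contradiction (↭-length π) λ ()

module FourAlternatives {A : Set} (dec : DecidableEquality A) (f g u z : A)
  (f≢g : f ≢ g) (f≢u : f ≢ u) (f≢z : f ≢ z) (g≢u : g ≢ u) (g≢z : g ≢ z) (u≢z : u ≢ z) where

  e : Alt → A
  e F = f
  e G = g
  e U = u
  e Z = z

  e-injective : Injective _≡_ _≡_ e
  e-injective {F} {F} _ = refl
  e-injective {G} {G} _ = refl
  e-injective {U} {U} _ = refl
  e-injective {Z} {Z} _ = refl
  e-injective {F} {G} p = ⊥-elim (f≢g p)
  e-injective {F} {U} p = ⊥-elim (f≢u p)
  e-injective {F} {Z} p = ⊥-elim (f≢z p)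
  e-injective {G} {U} p = ⊥-elim (g≢u p)
  e-injective {G} {Z} p = ⊥-elim (g≢z p)
  e-injective {U} {Z} p = ⊥-elim (u≢z p)
  e-injective {G} {F} p = ⊥-elim (f≢g (sym p))
  e-injective {U} {F} p = ⊥-elim (f≢u (sym p))
  e-injective {Z} {F} p = ⊥-elim (f≢z (sym p))
  e-injective {U} {G} p = ⊥-elim (g≢u (sym p))
  e-injective {Z} {G} p = ⊥-elim (g≢z (sym p))
  e-injective {Z} {U} p = ⊥-elim (u≢z (sym p))

  At-restrict-e⁺ : ∀ S w {k x} → At (w ↾ S) k x → At (restrict dec (map e S) (map e w)) k (e x)
  At-restrict-e⁺ = At-restrict-map⁺ dec _≟_ e-injective

  At-restrict-e⁻ : ∀ S w {k x} → At (restrict dec (map e S) (map e w)) k (e x) → At (w ↾ S) k x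
  At-restrict-e⁻ = At-restrict-map⁻ dec _≟_ e-injective

  transfer : ∀ {S₁ S₂ S₃ k₁ k₂ k₃ x₁ x₂ x₃} →
    (∀ w → FGUZ ↭ w → At (w ↾ S₁) k₁ x₁ → At (w ↾ S₂) k₂ x₂ ⊎ At (w ↾ S₃) k₃ x₃) →
    ∀ Q → Q ↭ map e FGUZ → At (restrict dec (map e S₁) Q) k₁ (e x₁) →
    At (restrict dec (map e S₂) Q) k₂ (e x₂) ⊎ At (restrict dec (map e S₃) Q) k₃ (e x₃)
  transfer claim Q π at with w , refl , π′ ← ↭-map-inv e (↭-sym π) =
    Sum.map (At-restrict-e⁺ _ w) (At-restrict-e⁺ _ w) (claim w π′ (At-restrict-e⁻ _ w at))

  switch-g-u-in-fgu : ∀ {G₂} → Switch g u (f ∷ g ∷ u ∷ []) G₂ → f ∷ u ∷ g ∷ [] ≡ G₂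
  switch-g-u-in-fgu ([]                , _ , eq   , _)   = ⊥-elim (f≢g (∷-injectiveˡ eq))
  switch-g-u-in-fgu (_ ∷ []            , _ , refl , refl) = refl
  switch-g-u-in-fgu (_ ∷ _ ∷ []        , _ , eq   , _)   =
    ⊥-elim (g≢u (sym (∷-injectiveˡ (∷-injectiveʳ (∷-injectiveʳ eq)))))
  switch-g-u-in-fgu (_ ∷ _ ∷ _ ∷ []    , _ , ()   , _)
  switch-g-u-in-fgu (_ ∷ _ ∷ _ ∷ _ ∷ _ , _ , ()   , _)

  fug-follows-fgu : ∀ {gs} → FirstSwitch g u gs → head gs ≡ just (f ∷ g ∷ u ∷ []) →
                    (f ∷ u ∷ g ∷ []) ∈ gs
  fug-follows-fgu (_ , _ , _ , refl , switch) refl = there (here (switch-g-u-in-fgu switch))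

  peak-pit-fgu⇒g-never-top : ∀ {E : Domain A} →
    E (f ∷ g ∷ u ∷ []) → E (f ∷ u ∷ g ∷ []) → E (u ∷ g ∷ f ∷ []) →
    PeakPitCD dec (f ∷ g ∷ u ∷ []) E → Never dec E f g u g 1
  peak-pit-fgu⇒g-never-top Efgu Efug Eugf peak-pit
    with peak-pit f g u (here refl) (there (here refl)) (there (there (here refl))) f≢g g≢u f≢u
  ... | _ , _ , here refl                 , inj₁ refl , never = ⊥-elim (never _ Efgu (At-restrict-e⁺ FGU FGU here))
  ... | _ , _ , here refl                 , inj₂ refl , never = ⊥-elim (never _ Eugf (At-restrict-e⁺ FGU UGF third))
  ... | _ , _ , there (here refl)         , inj₁ refl , never = never
  ... | _ , _ , there (here refl)         , inj₂ refl , never = ⊥-elim (never _ Efug (At-restrict-e⁺ FGU FUG third))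
  ... | _ , _ , there (there (here refl)) , inj₁ refl , never = ⊥-elim (never _ Eugf (At-restrict-e⁺ FGU UGF here))
  ... | _ , _ , there (there (here refl)) , inj₂ refl , never = ⊥-elim (never _ Efgu (At-restrict-e⁺ FGU FGU third))

  g-never-top-fgu : ∀ {D : Domain A} {gs} →
    Geodesic (f ∷ g ∷ u ∷ []) (f ∷ g ∷ u ∷ []) (u ∷ g ∷ f ∷ []) gs → FirstSwitch g u gs →
    PeakPitCD dec (f ∷ g ∷ u ∷ []) (λ P → Restr dec D (f ∷ g ∷ u ∷ []) P ⊎ P ∈ gs) →
    ∀ Q → D Q → ¬ At (restrict dec (f ∷ g ∷ u ∷ []) Q) 1 g
  g-never-top-fgu {D} {gs} ((_ , _ , first-is-fgu , last-is-ugf) , _) first-switch peak-pit =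
    Never-Restr⁻ dec λ P → never P ∘ inj₁
    where
    never : Never dec (λ P → Restr dec D (f ∷ g ∷ u ∷ []) P ⊎ P ∈ gs) f g u g 1
    never = peak-pit-fgu⇒g-never-top (inj₂ (head-∈ first-is-fgu))
                                     (inj₂ (fug-follows-fgu first-switch first-is-fgu))
                                     (inj₂ (last-∈ last-is-ugf)) peak-pit

  module _ {D : Domain A} (linear : ∀ Q → D Q → Q ↭ map e FGUZ)
           (g-never-top : ∀ Q → D Q → ¬ At (restrict dec (f ∷ g ∷ u ∷ []) Q) 1 g) where

    u-never-top-guz⇒u-never-top-fuz :
      (∀ Q → D Q → ¬ At (restrict dec (g ∷ u ∷ z ∷ []) Q) 1 u) →
      Never dec (Restr dec D (f ∷ u ∷ z ∷ [])) f u z u 1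
    u-never-top-guz⇒u-never-top-fuz u-never-top = Never-Restr⁺ dec λ Q DQ →
      [ u-never-top Q DQ , g-never-top Q DQ ]′
      ∘ transfer (λ w _ → u-top-fuz⇒u-top-guz⊎g-top-fgu w) Q (linear Q DQ)

    u-never-bottom-fuz⇒u-never-bottom-guz :
      Never dec (Restr dec D (f ∷ u ∷ z ∷ [])) f u z u 3 →
      Never dec (Restr dec D (g ∷ u ∷ z ∷ [])) g u z u 3
    u-never-bottom-fuz⇒u-never-bottom-guz never = Never-Restr⁺ dec λ Q DQ →
      [ Never-Restr⁻ dec never Q DQ , g-never-top Q DQ ]′
      ∘ transfer u-bottom-guz⇒u-bottom-fuz⊎g-top-fgu Q (linear Q DQ)

lemma17 : {A : Set} (dec : DecidableEquality A) (f g u z : A) →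
    f ≢ g → f ≢ u → f ≢ z → g ≢ u → g ≢ z → u ≢ z →
    (D : Domain A) →
    (∀ P → D P → IsLinOrder (f ∷ g ∷ u ∷ z ∷ []) P) →
    PeakPitCD dec (f ∷ g ∷ u ∷ z ∷ []) D →
    D (f ∷ g ∷ u ∷ z ∷ []) →
    D (z ∷ u ∷ g ∷ f ∷ []) →
    NpIsNeverTop dec (Restr dec D (g ∷ u ∷ z ∷ [])) g u z u →
    (gs : List (List A)) →
    Geodesic (f ∷ g ∷ u ∷ []) (f ∷ g ∷ u ∷ []) (u ∷ g ∷ f ∷ []) gs →
    PeakPitCD dec (f ∷ g ∷ u ∷ [])
      (λ P → Restr dec D (f ∷ g ∷ u ∷ []) P ⊎ P ∈ gs) →
    FirstSwitch g u gs →
    NpIsNeverTop dec (Restr dec D (f ∷ u ∷ z ∷ [])) f u z u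
lemma17 dec f g u z f≢g f≢u f≢z g≢u g≢z u≢z D linear _ DR DT np-guz gs geodesic peak-pit first-switch = np-fuz
  where
  open FourAlternatives dec f g u z f≢g f≢u f≢z g≢u g≢z u≢z

  g-never-top : ∀ Q → D Q → ¬ At (restrict dec (f ∷ g ∷ u ∷ []) Q) 1 g
  g-never-top = g-never-top-fgu geodesic first-switch peak-pit

  u-never-top-fuz : Never dec (Restr dec D (f ∷ u ∷ z ∷ [])) f u z u 1
  u-never-top-fuz = u-never-top-guz⇒u-never-top-fuz linear g-never-top
    (Never-Restr⁻ dec (Equivalence.from (np-guz u 1 (there (here refl)) (inj₁ refl)) (refl , refl)))

  u-sometimes-bottom-fuz : ¬ Never dec (Restr dec D (f ∷ u ∷ z ∷ [])) f u z u 3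
  u-sometimes-bottom-fuz never with () ← proj₂ (Equivalence.to (np-guz u 3 (there (here refl)) (inj₂ refl))
                                          (u-never-bottom-fuz⇒u-never-bottom-guz linear g-never-top never))

  refuted-by : ∀ w {k a} → D (map e w) → At (w ↾ FUZ) k a →
               ¬ Never dec (Restr dec D (f ∷ u ∷ z ∷ [])) f u z (e a) k
  refuted-by w Dw at never = Never-Restr⁻ dec never (map e w) Dw (At-restrict-e⁺ FUZ w at)

  np-fuz : NpIsNeverTop dec (Restr dec D (f ∷ u ∷ z ∷ [])) f u z u
  np-fuz _ _ (here refl)                 (inj₁ refl) = mk⇔ (⊥-elim ∘ refuted-by FGUZ DR here) (⊥-elim ∘ f≢u ∘ proj₁)
  np-fuz _ _ (here refl)                 (inj₂ refl) = mk⇔ (⊥-elim ∘ refuted-by ZUGF DT third) λ ()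
  np-fuz _ _ (there (here refl))         (inj₁ refl) = mk⇔ (λ _ → refl , refl) (λ _ → u-never-top-fuz)
  np-fuz _ _ (there (here refl))         (inj₂ refl) = mk⇔ (⊥-elim ∘ u-sometimes-bottom-fuz) λ ()
  np-fuz _ _ (there (there (here refl))) (inj₁ refl) = mk⇔ (⊥-elim ∘ refuted-by ZUGF DT here) (⊥-elim ∘ u≢z ∘ sym ∘ proj₁)
  np-fuz _ _ (there (there (here refl))) (inj₂ refl) = mk⇔ (⊥-elim ∘ refuted-by FGUZ DR third) λ ()
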